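{- Let $\mathcal B$ be a family of bad-events for permutations $\pi_1,\dots,\pi_N$ (with $\pi_k$ a permutation of $[n_k]$), all of size at most $M$, and let $n=n_1+\dots+n_N$. Let $I\subseteq\mathcal B$ be an arbitrary set of currently true bad-events which is independent with respect to $\sim$. For each $B\in I$ with triples $(k_1,x_1,y_1),\dots,(k_r,x_r,y_r)$, independently choose swap-mates $z_1,\dots,z_r$ as in the procedure Swap (for each $k$, the elements $x_l$ of $B$ in permutation $k$, taken in order, get $z_l$ chosen uniformly from $[n_k]$ minus the previously listed $x$'s of $B$ in permutation $k$); call $(k_l,x_l)$ the swap-sources and $(k_l,z_l)$ the swap-mates of $B$. Choose a uniformly random ordering $\rho$ of $I$, and let $G$ be the directed graph on vertex set $I$ with an edge from $B$ to $B'$ iff $\rho(B)<\rho(B')$ and some swap-mate of $B$ equals some swap-source of $B'$. Then with high probability (probability $1-n^{ -\Omega(1)}$), every directed path in $G$ has length $O(M+\log n)$.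
   Context: A bad-event $B$ is a finite set of triples $(k,x,y)$, $x,y\in[n_k]$, with no two triples $(k,x,y),(k,x,y')$, $y\ne y'$, and no two $(k,x,y),(k,x',y)$, $x\ne x'$; it is true iff $\pi_k(x)=y$ for all $(k,x,y)\in B$; its size is its number of triples. $B\sim B'$ iff there are $(k,x,y)\in B$, $(k,x',y')\in B'$ with $x=x'$ or $y=y'$; a set is independent if no two distinct members are $\sim$-related. The procedure $\mathrm{Swap}(\pi;x_1,\dots,x_r)$ on a permutation of $[t]$ chooses, for $i=1,\dots,r$, $x_i'$ uniformly from $[t]\setminus\{x_1,\dots,x_{i-1}\}$ and exchanges entries $x_i$ and $x_i'$. -}

module Defs where

open import Data.Nat using (ℕ; zero; suc; _+_; _*_; _^_; _≤_; _<_)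
open import Data.Fin as Fin using (Fin; toℕ; inject₁)
open import Data.Fin.Permutation using (Permutation′; _⟨$⟩ʳ_)
open import Data.List as List using (List; []; _∷_; [_]; length; filter; concatMap; allFin)
open import Data.Nat.ListAction using (sum)
open import Data.List.Membership.Propositional using (_∈_)
import Data.List.Membership.DecPropositional as DecMem
open import Data.List.Relation.Unary.All using (All)
open import Data.Vec as Vec using (Vec)
open import Data.Product using (Σ; ∃; _×_; _,_; proj₁; proj₂)
open import Data.Product.Properties using (≡-dec)
open import Data.Sum using (_⊎_)
open import Relation.Nullary using (¬_; ¬?)
open import Relation.Binary.PropositionalEquality using (_≡_; _≢_)
open import Relation.Binary.Definitions using (DecidableEquality)

prodVec : ∀ {A : Set} {m : ℕ} → Vec (List A) m → List (Vec A m)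
prodVec Vec.[] = [ Vec.[] ]
prodVec (xs Vec.∷ xss) = concatMap (λ x → List.map (x Vec.∷_) (prodVec xss)) xs

injSeqs : (m : ℕ) → List (Fin m) → (k : ℕ) → List (Vec (Fin m) k)
injSeqs m used zero = [ Vec.[] ]
injSeqs m used (suc k) =
  concatMap (λ a → List.map (a Vec.∷_) (injSeqs m (a ∷ used) k))
            (filter (λ a → ¬? (DecMem._∈?_ Fin._≟_ a used)) (allFin m))

-- Uniform random ordering ρ of an m-element set: ρ is given by the vector of
-- ranks (a bijection Fin m → Fin m), each listed exactly once.
rankings : (m : ℕ) → List (Vec (Fin m) m)
rankings m = injSeqs m [] m

module Setting (N : ℕ) (ns : Fin N → ℕ) where

  total : ℕ
  total = sum (List.map ns (allFin N))

  Pos : Set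
  Pos = Σ (Fin N) (λ k → Fin (ns k))

  _≟Pos_ : DecidableEquality Pos
  _≟Pos_ = ≡-dec Fin._≟_ Fin._≟_

  record Triple : Set where
    constructor triple
    field
      k : Fin N
      x : Fin (ns k)
      y : Fin (ns k)
  open Triple public

  source : Triple → Pos
  source t = (k t , x t)

  target : Triple → Pos
  target t = (k t , y t)

  BadEvent : Set
  BadEvent = List Triple

  WellFormed : BadEvent → Set
  WellFormed B = ∀ (i j : Fin (length B)) → i ≢ j →
    (source (List.lookup B i) ≢ source (List.lookup B j)) ×
    (target (List.lookup B i) ≢ target (List.lookup B j))

  size : BadEvent → ℕ
  size = length

  IsTrue : ((j : Fin N) → Permutation′ (ns j)) → BadEvent → Set
  IsTrue π B = All (λ t → (π (k t) ⟨$⟩ʳ x t) ≡ y t) B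

  _∼_ : BadEvent → BadEvent → Set
  B ∼ B' = ∃ λ t → ∃ λ t' → t ∈ B × t' ∈ B' ×
             (source t ≡ source t' ⊎ target t ≡ target t')

  Independent : ∀ {m} → Vec BadEvent m → Set
  Independent {m} I = ∀ (i j : Fin m) → i ≢ j → ¬ (Vec.lookup I i ∼ Vec.lookup I j)

  candidates : List Pos → Triple → List Pos
  candidates prev t =
    List.map (λ z → (k t , z))
      (filter (λ z → ¬? (DecMem._∈?_ _≟Pos_ (k t , z) prev)) (allFin (ns (k t))))

  -- All possible swap-mate sequences (z_1, ..., z_r) for a bad-event,
  -- each listed exactly once (uniform distribution = uniform on this list).
  mateSeqs : List Pos → BadEvent → List (List Pos)
  mateSeqs prev [] = [ [] ]
  mateSeqs prev (t ∷ ts) =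
    concatMap (λ z → List.map (z ∷_) (mateSeqs (source t ∷ prev) ts))
              (candidates prev t)

  Outcome : ℕ → Set
  Outcome m = Vec (Fin m) m × Vec (List Pos) m

  -- The (uniform) sample space: every outcome listed exactly once.
  outcomes : ∀ {m} → Vec BadEvent m → List (Outcome m)
  outcomes {m} I =
    concatMap (λ ρ → List.map (ρ ,_) (prodVec (Vec.map (mateSeqs []) I)))
              (rankings m)

  Edge : ∀ {m} → Vec BadEvent m → Outcome m → Fin m → Fin m → Set
  Edge I (ρ , z) i j =
    (toℕ (Vec.lookup ρ i) < toℕ (Vec.lookup ρ j)) ×
    (∃ λ p → p ∈ Vec.lookup z i × p ∈ List.map source (Vec.lookup I j))

  Path : ∀ {m} → Vec BadEvent m → Outcome m → ℕ → Set
  Path {m} I o L = Σ (Vec (Fin m) (suc L)) λ vs →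
    ∀ (l : Fin L) → Edge I o (Vec.lookup vs (inject₁ l)) (Vec.lookup vs (Fin.suc l))

  LongPath : ∀ {m} → Vec BadEvent m → Outcome m → ℕ → Set
  LongPath I o bound = Σ ℕ λ L → bound < L × Path I o L

module Submission where

open import Defs
open import Data.Nat using (ℕ; suc; _+_; _*_; _^_; _≤_)
open import Data.Nat.Logarithm using (⌊log₂_⌋)
open import Data.Fin using (Fin)
open import Data.Fin.Permutation using (Permutation′)
open import Data.List using (List; length; lookup)
open import Data.List.Relation.Unary.All using (All)
open import Data.List.Relation.Unary.Unique.Propositional using (Unique)
open import Data.Vec using (Vec)
import Data.Vec as Vec
open import Data.Product using (Σ)
open import Relation.Binary.PropositionalEquality using (_≡_)

-- Let L = 32(M + ⌊log₂ n⌋ + 1).  An outcome (ranking ρ of I,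
-- swap-mates z) with a path V₀ → V₁ → … of more than L edges, together with any
-- permutation σ of the L+1 vertices w = V₁, …, V_{L+1}, is encoded by the outcome
-- obtained by rearranging the ranks of w along σ (same z), plus a code: the swap-source
-- of V₁ hit by a swap-mate of V₀, and for each edge of w the index (< M) of the
-- swap-mate used.  Since I is independent, a position is the swap-source of at most one
-- event, so z and the code recover w; since ρ ranks w increasingly, the rearranged
-- ranks recover ρ and σ.  Hence (long-path outcomes)·(L+1)! ≤ |outcomes|·n·M^L, and
-- n²·M^L ≤ (L+1)! gives that at most a 1/n fraction of the outcomes has a long path.
--
-- The factorial estimate behind the choice of the path-length bound.
module Arithmetic where

  open import Data.Nat
  open import Data.Nat.Properties
  open import Data.Nat.Induction using (<-rec)
  open import Data.Nat.Logarithm using (⌊log₂_⌋; ⌊log₂⌋-mono-≤; ⌊log₂[2^n]⌋≡n)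
  open import Data.Nat.Solver using (module +-*-Solver)
  open import Data.Product using (Σ; _,_)
  open import Data.Sum using (_⊎_; inj₁; inj₂)
  open import Relation.Binary.PropositionalEquality
  open import Relation.Nullary using (yes; no; contradiction)
  open +-*-Solver using (solve; _:=_; _:*_; _:+_; con)

  ^-distribʳ-* : ∀ a b c → (a * b) ^ c ≡ a ^ c * b ^ c
  ^-distribʳ-* a b zero = refl
  ^-distribʳ-* a b (suc c) rewrite ^-distribʳ-* a b c =
    solve 4 (λ a b x y → (a :* b) :* (x :* y) := (a :* x) :* (b :* y)) refl a b (a ^ c) (b ^ c)

  -- The factors b+1, …, b+c of (b+c)! are each at least b.
  !*^≤! : ∀ b c → b ! * b ^ c ≤ (b + c) !
  !*^≤! b zero rewrite +-identityʳ b | *-identityʳ (b !) = ≤-refl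
  !*^≤! b (suc c) rewrite +-suc b c = begin
      b ! * (b * b ^ c)   ≡⟨ solve 3 (λ f b x → f :* (b :* x) := b :* (f :* x)) refl (b !) b (b ^ c) ⟩
      b * (b ! * b ^ c)   ≤⟨ *-mono-≤ (≤-trans (m≤m+n b c) (n≤1+n _)) (!*^≤! b c) ⟩
      suc (b + c) * (b + c) ! ∎
    where open ≤-Reasoning

  StirlingBound : ℕ → Set
  StirlingBound a = a ^ a ≤ 8 ^ a * a !

  -- The bound for b yields the bound for 2b, since (2b)^(2b) = 4^b·b^b·b^b and b!·b^b ≤ (2b)!.
  stirling-double : ∀ b → StirlingBound b → StirlingBound (b + b)
  stirling-double b ih = begin
      (b + b) ^ (b + b)                   ≡⟨ ^-distribˡ-+-* (b + b) b b ⟩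
      (b + b) ^ b * (b + b) ^ b           ≡⟨ cong (λ x → x ^ b * x ^ b) (solve 1 (λ b → b :+ b := con 2 :* b) refl b) ⟩
      (2 * b) ^ b * (2 * b) ^ b           ≡⟨ cong₂ _*_ (^-distribʳ-* 2 b b) (^-distribʳ-* 2 b b) ⟩
      (2 ^ b * b ^ b) * (2 ^ b * b ^ b)   ≤⟨ *-monoʳ-≤ (2 ^ b * b ^ b) (*-monoʳ-≤ (2 ^ b) ih) ⟩
      (2 ^ b * b ^ b) * (2 ^ b * (8 ^ b * b !))
        ≡⟨ solve 4 (λ t x e f → (t :* x) :* (t :* (e :* f)) := (t :* (t :* e)) :* (f :* x)) refl (2 ^ b) (b ^ b) (8 ^ b) (b !) ⟩
      (2 ^ b * (2 ^ b * 8 ^ b)) * (b ! * b ^ b) ≤⟨ *-mono-≤ powers (!*^≤! b b) ⟩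
      8 ^ (b + b) * (b + b) ! ∎
    where
      open ≤-Reasoning
      powers : 2 ^ b * (2 ^ b * 8 ^ b) ≤ 8 ^ (b + b)
      powers = begin
        2 ^ b * (2 ^ b * 8 ^ b) ≡⟨ sym (*-assoc (2 ^ b) (2 ^ b) (8 ^ b)) ⟩
        (2 ^ b * 2 ^ b) * 8 ^ b ≡⟨ cong (_* 8 ^ b) (sym (^-distribʳ-* 2 2 b)) ⟩
        4 ^ b * 8 ^ b           ≤⟨ *-monoˡ-≤ (8 ^ b) (^-monoˡ-≤ b (s≤s (s≤s (s≤s (s≤s z≤n))))) ⟩
        8 ^ b * 8 ^ b           ≡⟨ sym (^-distribˡ-+-* 8 b b) ⟩
        8 ^ (b + b) ∎

  -- The bound for b+1 yields the bound for 2b+1 when b ≥ 1, since 2b+1 ≤ 2(b+1)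
  -- and (b+1)!·(b+1)^b ≤ (2b+1)!.
  stirling-double+1 : ∀ b → 1 ≤ b → StirlingBound (suc b) → StirlingBound (suc (b + b))
  stirling-double+1 b 1≤b ih = begin
      s ^ s                                         ≤⟨ ^-monoˡ-≤ s s≤2[1+b] ⟩
      (2 * suc b) ^ s                               ≡⟨ ^-distribʳ-* 2 (suc b) s ⟩
      2 ^ s * suc b ^ (suc b + b)                   ≡⟨ cong (2 ^ s *_) (^-distribˡ-+-* (suc b) (suc b) b) ⟩
      2 ^ s * (suc b ^ suc b * suc b ^ b)           ≤⟨ *-monoʳ-≤ (2 ^ s) (*-monoˡ-≤ (suc b ^ b) ih) ⟩
      2 ^ s * ((8 ^ suc b * suc b !) * suc b ^ b)
        ≡⟨ solve 4 (λ t e f x → t :* ((e :* f) :* x) := (t :* e) :* (f :* x)) refl (2 ^ s) (8 ^ suc b) (suc b !) (suc b ^ b) ⟩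
      (2 ^ s * 8 ^ suc b) * (suc b ! * suc b ^ b)   ≤⟨ *-mono-≤ powers (!*^≤! (suc b) b) ⟩
      8 ^ s * s ! ∎
    where
      open ≤-Reasoning
      s : ℕ
      s = suc (b + b)
      s≤2[1+b] : s ≤ 2 * suc b
      s≤2[1+b] = subst (s ≤_) (solve 1 (λ b → con 1 :+ (con 1 :+ (b :+ b)) := con 2 :* (con 1 :+ b)) refl b) (n≤1+n s)
      s≤3b : s ≤ 3 * b
      s≤3b = subst (_≤ 3 * b) (solve 1 (λ b → b :+ (b :+ con 1) := con 1 :+ (b :+ b)) refl b)
               (+-monoʳ-≤ b (+-monoʳ-≤ b (subst (1 ≤_) (sym (+-identityʳ b)) 1≤b)))
      powers : 2 ^ s * 8 ^ suc b ≤ 8 ^ s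
      powers = begin
        2 ^ s * 8 ^ suc b         ≤⟨ *-monoˡ-≤ (8 ^ suc b) (^-monoʳ-≤ 2 s≤3b) ⟩
        2 ^ (3 * b) * 8 ^ suc b   ≡⟨ cong (_* 8 ^ suc b) (sym (^-*-assoc 2 3 b)) ⟩
        8 ^ b * 8 ^ suc b         ≡⟨ sym (^-distribˡ-+-* 8 b (suc b)) ⟩
        8 ^ (b + suc b)           ≡⟨ cong (8 ^_) (+-suc b b) ⟩
        8 ^ s ∎

  halve : ∀ a → Σ ℕ λ b → a ≡ b + b ⊎ a ≡ suc (b + b)
  halve zero = 0 , inj₁ refl
  halve (suc a) with halve a
  ... | b , inj₁ e = b , inj₂ (cong suc e)
  ... | b , inj₂ e = suc b , inj₁ (trans (cong suc e) (cong suc (sym (+-suc b b))))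

  stirling : ∀ a → StirlingBound a
  stirling = <-rec StirlingBound step
    where
      step : ∀ a → (∀ {a'} → a' < a → StirlingBound a') → StirlingBound a
      step zero _ = ≤-refl
      step (suc zero) _ = s≤s z≤n
      step a@(suc (suc _)) ih with halve a
      ... | zero , inj₁ ()
      ... | zero , inj₂ ()
      ... | b@(suc _) , inj₁ a≡2b =
        subst StirlingBound (sym a≡2b) (stirling-double b (ih (subst (b <_) (sym a≡2b) (m<m+n b (s≤s z≤n)))))
      ... | b@(suc _) , inj₂ a≡2b+1 =
        subst StirlingBound (sym a≡2b+1) (stirling-double+1 b (s≤s z≤n)
          (ih (subst (suc b <_) (sym a≡2b+1) (s≤s (m<m+n b (s≤s z≤n))))))

  n<2^[1+⌊log₂n⌋] : ∀ n → n < 2 ^ suc ⌊log₂ n ⌋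
  n<2^[1+⌊log₂n⌋] n with n <? 2 ^ suc ⌊log₂ n ⌋
  ... | yes n< = n<
  ... | no n≮ = contradiction (subst (_≤ ⌊log₂ n ⌋) (⌊log₂[2^n]⌋≡n (suc ⌊log₂ n ⌋)) (⌊log₂⌋-mono-≤ (≮⇒≥ n≮)))
                              (<⇒≱ (n<1+n ⌊log₂ n ⌋))

  -- The length bound L = 32(M + ⌊log₂ n⌋ + 1) of the theorem satisfies n²·M^L ≤ (L+1)!:
  -- with K = M + ⌊log₂ n⌋ + 1 we have n ≤ 2^K and M ≤ K, so 8^L·n²·M^L ≤ 8^L·4^K·K^L
  -- ≤ (32K)^L = L^L ≤ 8^L·L! by the Stirling-type bound.
  pathBudget : ∀ n M → let L = 32 * suc (M + ⌊log₂ n ⌋) in n * (n * M ^ L) ≤ suc L !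
  pathBudget n M = *-cancelˡ-≤ (8 ^ L) {{m^n≢0 8 L}} (begin
      8 ^ L * (n * (n * M ^ L))         ≤⟨ *-monoʳ-≤ (8 ^ L) (*-mono-≤ n≤2^K (*-mono-≤ n≤2^K (^-monoˡ-≤ L M≤K))) ⟩
      8 ^ L * (2 ^ K * (2 ^ K * K ^ L)) ≡⟨ cong (8 ^ L *_) (sym (*-assoc (2 ^ K) (2 ^ K) (K ^ L))) ⟩
      8 ^ L * ((2 ^ K * 2 ^ K) * K ^ L) ≡⟨ cong (λ x → 8 ^ L * (x * K ^ L)) (sym (^-distribʳ-* 2 2 K)) ⟩
      8 ^ L * (4 ^ K * K ^ L)           ≤⟨ *-monoʳ-≤ (8 ^ L) (*-monoˡ-≤ (K ^ L) (^-monoʳ-≤ 4 (m≤n*m K 32))) ⟩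
      8 ^ L * (4 ^ L * K ^ L)           ≡⟨ cong (8 ^ L *_) (sym (^-distribʳ-* 4 K L)) ⟩
      8 ^ L * (4 * K) ^ L               ≡⟨ sym (^-distribʳ-* 8 (4 * K) L) ⟩
      (8 * (4 * K)) ^ L                 ≡⟨ cong (_^ L) (sym (*-assoc 8 4 K)) ⟩
      L ^ L                             ≤⟨ stirling L ⟩
      8 ^ L * L !                       ≤⟨ *-monoʳ-≤ (8 ^ L) (m≤n*m (L !) (suc L)) ⟩
      8 ^ L * suc L ! ∎)
    where
      open ≤-Reasoning
      K L : ℕ
      K = suc (M + ⌊log₂ n ⌋)
      L = 32 * K
      n≤2^K : n ≤ 2 ^ K
      n≤2^K = ≤-trans (<⇒≤ (n<2^[1+⌊log₂n⌋] n)) (^-monoʳ-≤ 2 (s≤s (m≤n+m ⌊log₂ n ⌋ M)))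
      M≤K : M ≤ K
      M≤K = ≤-trans (m≤m+n M _) (n≤1+n _)

module FiniteLists where

  open import Data.Nat using (_+_; _*_; _≤_)
  open import Data.Nat.Properties using (≤-refl; +-mono-≤)
  open import Data.Nat.ListAction using (sum)
  open import Data.Fin using (Fin; zero; suc)
  open import Data.Fin.Properties using (injective⇒≤)
  open import Data.List using (List; []; _∷_; length; lookup; map; concatMap)
  open import Data.List.Properties using (length-map; length-++)
  open import Data.List.Membership.Propositional using (_∈_)
  open import Data.List.Membership.Propositional.Properties
    using (∈-lookup; ∈-map⁺; ∈-map⁻; ∈-++⁺ˡ; ∈-++⁺ʳ; ∈-++⁻)
  open import Data.List.Relation.Unary.Any using (here; there; index)
  open import Data.List.Relation.Unary.Any.Properties using (lookup-index)
  import Data.List.Relation.Unary.All as All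
  open import Data.List.Relation.Unary.All using ([]; _∷_)
  open import Data.List.Relation.Unary.AllPairs using ([]; _∷_)
  open import Data.List.Relation.Unary.Unique.Propositional using (Unique)
  import Data.List.Relation.Unary.Unique.Propositional.Properties as Unique
  open import Data.Product using (∃; _×_; _,_; proj₁; proj₂)
  open import Data.Sum using (inj₁; inj₂)
  open import Function.Definitions using (Injective)
  open import Relation.Binary.PropositionalEquality
  open import Relation.Nullary using (¬_; contradiction)

  module _ {A : Set} where

    lookup-injective : ∀ {xs : List A} → Unique xs → Injective _≡_ _≡_ (lookup xs)
    lookup-injective (_ ∷ _) {zero} {zero} _ = refl
    lookup-injective (x∉ ∷ _) {zero} {suc j} e = contradiction e (All.lookup x∉ (∈-lookup j))
    lookup-injective (x∉ ∷ _) {suc i} {zero} e = contradiction (sym e) (All.lookup x∉ (∈-lookup i))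
    lookup-injective (_ ∷ u) {suc i} {suc j} e = cong suc (lookup-injective u e)

    unique⇒length≤ : ∀ {xs ys : List A} → Unique xs → (∀ {x} → x ∈ xs → x ∈ ys) → length xs ≤ length ys
    unique⇒length≤ {xs} {ys} u xs⊆ys = injective⇒≤ position-injective
      where
        position : Fin (length xs) → Fin (length ys)
        position i = index (xs⊆ys (∈-lookup {xs = xs} i))
        position-injective : Injective _≡_ _≡_ position
        position-injective {i} {j} e = lookup-injective u (begin
          lookup xs i              ≡⟨ lookup-index (xs⊆ys (∈-lookup {xs = xs} i)) ⟩
          lookup ys (position i)   ≡⟨ cong (lookup ys) e ⟩
          lookup ys (position j)   ≡⟨ lookup-index (xs⊆ys (∈-lookup {xs = xs} j)) ⟨
          lookup xs j              ∎)
          where open ≡-Reasoning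

    map-unique : ∀ {B : Set} {f : A → B} {xs} → Unique xs →
      (∀ {x y} → x ∈ xs → y ∈ xs → f x ≡ f y → x ≡ y) → Unique (map f xs)
    map-unique {xs = []} _ _ = []
    map-unique {f = f} {xs = x ∷ xs} (x∉ ∷ u) f-inj =
      All.tabulate fx∉ ∷ map-unique u (λ x∈ y∈ → f-inj (there x∈) (there y∈))
      where
        fx∉ : ∀ {v} → v ∈ map f xs → f x ≢ v
        fx∉ v∈ e with y , y∈ , refl ← ∈-map⁻ f v∈ = All.lookup x∉ y∈ (f-inj (here refl) (there y∈) e)

  unique-key : ∀ {A K : Set} (key : A → K) {xs : List A} → Unique (map key xs) →
    ∀ {a a'} → a ∈ xs → a' ∈ xs → key a ≡ key a' → a ≡ a'
  unique-key key _ (here refl) (here refl) _ = refl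
  unique-key key (k∉ ∷ _) (here refl) (there a'∈) e = contradiction e (All.lookup k∉ (∈-map⁺ key a'∈))
  unique-key key (k∉ ∷ _) (there a∈) (here refl) e = contradiction (sym e) (All.lookup k∉ (∈-map⁺ key a∈))
  unique-key key (_ ∷ u) (there a∈) (there a'∈) e = unique-key key u a∈ a'∈ e

  toList-keys : ∀ {A : Set} {P : A → Set} {xs} (ps : All.All P xs) → map proj₁ (All.toList ps) ≡ xs
  toList-keys [] = refl
  toList-keys (_ ∷ ps) = cong (_ ∷_) (toList-keys ps)

  length-concatMap : ∀ {A B : Set} (f : A → List B) xs → length (concatMap f xs) ≡ sum (map (λ a → length (f a)) xs)
  length-concatMap f [] = refl
  length-concatMap f (x ∷ xs) = trans (length-++ (f x)) (cong (length (f x) +_) (length-concatMap f xs))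

  -- Products of lists: all values g a b with a from a list xs and b from G a.
  -- Most enumerations in Defs (sequences, outcomes) are of this shape.
  module Pairs {A B C : Set} (g : A → B → C) (G : A → List B) where

    pairs : List A → List C
    pairs = concatMap (λ a → map (g a) (G a))

    pairs-∈⁺ : ∀ {xs a b} → a ∈ xs → b ∈ G a → g a b ∈ pairs xs
    pairs-∈⁺ {x ∷ _} (here refl) b∈ = ∈-++⁺ˡ (∈-map⁺ (g x) b∈)
    pairs-∈⁺ {x ∷ _} (there a∈) b∈ = ∈-++⁺ʳ (map (g x) (G x)) (pairs-∈⁺ a∈ b∈)

    pairs-∈⁻ : ∀ xs {c} → c ∈ pairs xs → ∃ λ a → ∃ λ b → a ∈ xs × b ∈ G a × c ≡ g a b
    pairs-∈⁻ (x ∷ xs) c∈ with ∈-++⁻ (map (g x) (G x)) c∈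
    ... | inj₁ c∈x with b , b∈ , e ← ∈-map⁻ (g x) c∈x = x , b , here refl , b∈ , e
    ... | inj₂ c∈xs with a , b , a∈ , b∈ , e ← pairs-∈⁻ xs c∈xs = a , b , there a∈ , b∈ , e

    pairs-unique : ∀ {xs} → Unique xs → (∀ a → Unique (G a)) →
      (∀ {a a' b b'} → a ∈ xs → a' ∈ xs → b ∈ G a → b' ∈ G a' → g a b ≡ g a' b' → a ≡ a' × b ≡ b') →
      Unique (pairs xs)
    pairs-unique {[]} _ _ _ = []
    pairs-unique {x ∷ xs} (x∉ ∷ u) uG g-inj =
      Unique.++⁺ (map-unique (uG x) (λ b∈ b'∈ e → proj₂ (g-inj (here refl) (here refl) b∈ b'∈ e)))
        (pairs-unique u uG (λ a∈ a'∈ → g-inj (there a∈) (there a'∈))) disjoint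
      where
        disjoint : ∀ {c} → ¬ (c ∈ map (g x) (G x) × c ∈ pairs xs)
        disjoint (c∈x , c∈xs) with b , b∈ , refl ← ∈-map⁻ (g x) c∈x with a , b' , a∈ , b'∈ , e ← pairs-∈⁻ xs c∈xs =
          All.lookup x∉ a∈ (proj₁ (g-inj (here refl) (there a∈) b∈ b'∈ e))

    pairs-length-≥ : ∀ {xs k} → (∀ a → k ≤ length (G a)) → length xs * k ≤ length (pairs xs)
    pairs-length-≥ {[]} _ = ≤-refl
    pairs-length-≥ {x ∷ xs} bound rewrite length-++ (map (g x) (G x)) {pairs xs} | length-map (g x) (G x) =
      +-mono-≤ (bound x) (pairs-length-≥ {xs} bound)

    pairs-length-≡ : ∀ {xs k} → (∀ a → length (G a) ≡ k) → length (pairs xs) ≡ length xs * k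
    pairs-length-≡ {[]} _ = refl
    pairs-length-≡ {x ∷ xs} len rewrite length-++ (map (g x) (G x)) {pairs xs} | length-map (g x) (G x) =
      cong₂ _+_ (len x) (pairs-length-≡ {xs} len)

module Enumerations where

  open import Defs
  open FiniteLists
  open Pairs
  open import Data.Nat using (ℕ; zero; suc; _+_; _*_; _^_; _∸_; _≤_; _!)
  open import Data.Nat.Properties using (≤-refl; *-monoˡ-≤; m≤n+o⇒m∸n≤o; ∸-+-assoc; +-comm; module ≤-Reasoning)
  open import Data.Nat.ListAction using (sum)
  open import Data.Fin as Fin using (Fin; zero; suc)
  open import Data.Fin.Properties using (suc-injective)
  open import Data.List using (List; []; _∷_; length; map; concatMap; filter; allFin; _++_)
  open import Data.List.Properties using (length-++; length-map; length-tabulate; ∷-injective; map-cong)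
  open import Data.List.Membership.Propositional using (_∈_; _∉_; lose)
  open import Data.List.Membership.Propositional.Properties
    using (∈-allFin; ∈-filter⁺; ∈-filter⁻; ∈-++⁺ˡ; ∈-++⁺ʳ; ∈-map⁺; ∈-concatMap⁺)
  import Data.List.Membership.DecPropositional as DecMembership
  open import Data.List.Relation.Unary.Any using (here; there)
  open import Data.List.Relation.Unary.All using ([])
  open import Data.List.Relation.Unary.AllPairs using ([]; _∷_)
  open import Data.List.Relation.Unary.Unique.Propositional using (Unique)
  import Data.List.Relation.Unary.Unique.Propositional.Properties as Unique
  open import Data.Vec as Vec using (Vec)
  import Data.Vec.Properties as Vec
  open import Data.Product using (_×_; _,_; proj₂)
  open import Function.Definitions using (Injective)
  open import Relation.Binary.PropositionalEquality
  open import Relation.Nullary using (¬?; yes; no; contradiction)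
  open import Relation.Unary using (Decidable)

  unused? : ∀ {m} (used : List (Fin m)) → Decidable (_∉ used)
  unused? used a = ¬? (DecMembership._∈?_ Fin._≟_ a used)

  fresh : (m : ℕ) → List (Fin m) → List (Fin m)
  fresh m used = filter (unused? used) (allFin m)

  fresh-length : ∀ m used → m ∸ length used ≤ length (fresh m used)
  fresh-length m used = m≤n+o⇒m∸n≤o m (length used) (begin
      m                                      ≡⟨ length-tabulate {n = m} (λ a → a) ⟨
      length (allFin m)                      ≤⟨ unique⇒length≤ (Unique.allFin⁺ m) allFin⊆ ⟩
      length (used ++ fresh m used)          ≡⟨ length-++ used ⟩
      length used + length (fresh m used)    ∎)
    where
      open ≤-Reasoning
      allFin⊆ : ∀ {a} → a ∈ allFin m → a ∈ used ++ fresh m used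
      allFin⊆ {a} a∈ with DecMembership._∈?_ Fin._≟_ a used
      ... | yes a∈used = ∈-++⁺ˡ a∈used
      ... | no a∉used = ∈-++⁺ʳ used (∈-filter⁺ (unused? used) a∈ a∉used)

  injSeqs-sound : ∀ m used k {v : Vec (Fin m) k} → v ∈ injSeqs m used k →
    Injective _≡_ _≡_ (Vec.lookup v) × (∀ i → Vec.lookup v i ∉ used)
  injSeqs-sound m used zero {Vec.[]} _ = (λ {}) , (λ ())
  injSeqs-sound m used (suc k) {v} v∈
    with a , w , a∈ , w∈ , refl ← pairs-∈⁻ Vec._∷_ (λ a → injSeqs m (a ∷ used) k) (fresh m used) v∈
    with w-inj , w-avoids ← injSeqs-sound m (a ∷ used) k w∈ = v-inj , v-avoids
    where
      v-inj : Injective _≡_ _≡_ (Vec.lookup (a Vec.∷ w))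
      v-inj {zero} {zero} _ = refl
      v-inj {zero} {suc j} e = contradiction (here (sym e)) (w-avoids j)
      v-inj {suc i} {zero} e = contradiction (here e) (w-avoids i)
      v-inj {suc i} {suc j} e = cong suc (w-inj e)
      v-avoids : ∀ i → Vec.lookup (a Vec.∷ w) i ∉ used
      v-avoids zero = proj₂ (∈-filter⁻ (unused? used) {xs = allFin m} a∈)
      v-avoids (suc i) a∈used = w-avoids i (there a∈used)

  injSeqs-complete : ∀ m used k (v : Vec (Fin m) k) → Injective _≡_ _≡_ (Vec.lookup v) →
    (∀ i → Vec.lookup v i ∉ used) → v ∈ injSeqs m used k
  injSeqs-complete m used zero Vec.[] _ _ = here refl
  injSeqs-complete m used (suc k) (a Vec.∷ w) v-inj v-avoids =
    pairs-∈⁺ Vec._∷_ (λ a → injSeqs m (a ∷ used) k)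
      (∈-filter⁺ (unused? used) (∈-allFin a) (v-avoids zero))
      (injSeqs-complete m (a ∷ used) k w (λ e → suc-injective (v-inj e)) w-avoids)
    where
      w-avoids : ∀ i → Vec.lookup w i ∉ (a ∷ used)
      w-avoids i (here e) with () ← v-inj {suc i} {zero} e
      w-avoids i (there w∈used) = v-avoids (suc i) w∈used

  injSeqs-unique : ∀ m used k → Unique (injSeqs m used k)
  injSeqs-unique m used zero = [] ∷ []
  injSeqs-unique m used (suc k) =
    pairs-unique Vec._∷_ (λ a → injSeqs m (a ∷ used) k)
      (Unique.filter⁺ (unused? used) (Unique.allFin⁺ m))
      (λ a → injSeqs-unique m (a ∷ used) k) (λ _ _ _ _ → Vec.∷-injective)

  fallingFactorial : ℕ → ℕ → ℕ
  fallingFactorial r zero = 1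
  fallingFactorial r (suc k) = r * fallingFactorial (r ∸ 1) k

  injSeqs-length : ∀ m used k → fallingFactorial (m ∸ length used) k ≤ length (injSeqs m used k)
  injSeqs-length m used zero = ≤-refl
  injSeqs-length m used (suc k) = begin
      (m ∸ length used) * fallingFactorial (m ∸ length used ∸ 1) k
        ≡⟨ cong (λ r → (m ∸ length used) * fallingFactorial r k) (trans (∸-+-assoc m (length used) 1) (cong (m ∸_) (+-comm (length used) 1))) ⟩
      (m ∸ length used) * fallingFactorial (m ∸ suc (length used)) k
        ≤⟨ *-monoˡ-≤ _ (fresh-length m used) ⟩
      length (fresh m used) * fallingFactorial (m ∸ suc (length used)) k
        ≤⟨ pairs-length-≥ Vec._∷_ (λ a → injSeqs m (a ∷ used) k) {fresh m used} (λ a → injSeqs-length m (a ∷ used) k) ⟩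
      length (injSeqs m used (suc k)) ∎
    where open ≤-Reasoning

  rankings-length : ∀ m → m ! ≤ length (rankings m)
  rankings-length m = subst (_≤ length (rankings m)) (fallingFactorial-full m) (injSeqs-length m [] m)
    where
      fallingFactorial-full : ∀ n → fallingFactorial n n ≡ n !
      fallingFactorial-full zero = refl
      fallingFactorial-full (suc n) = cong (suc n *_) (fallingFactorial-full n)

  module _ {A : Set} where

    prodVec-sound : ∀ {m} (xss : Vec (List A) m) {z} → z ∈ prodVec xss → ∀ i → Vec.lookup z i ∈ Vec.lookup xss i
    prodVec-sound (xs Vec.∷ xss) {z} z∈
      with a , w , a∈ , w∈ , refl ← pairs-∈⁻ Vec._∷_ (λ _ → prodVec xss) xs z∈ = λ where
        zero → a∈
        (suc i) → prodVec-sound xss w∈ i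

    prodVec-complete : ∀ {m} (xss : Vec (List A) m) z → (∀ i → Vec.lookup z i ∈ Vec.lookup xss i) → z ∈ prodVec xss
    prodVec-complete Vec.[] Vec.[] _ = here refl
    prodVec-complete (xs Vec.∷ xss) (a Vec.∷ z) z∈ =
      pairs-∈⁺ Vec._∷_ (λ _ → prodVec xss) (z∈ zero) (prodVec-complete xss z (λ i → z∈ (suc i)))

    prodVec-unique : ∀ {m} (xss : Vec (List A) m) → (∀ i → Unique (Vec.lookup xss i)) → Unique (prodVec xss)
    prodVec-unique Vec.[] _ = [] ∷ []
    prodVec-unique (xs Vec.∷ xss) u =
      pairs-unique Vec._∷_ (λ _ → prodVec xss) (u zero) (λ _ → prodVec-unique xss (λ i → u (suc i))) (λ _ _ _ _ → Vec.∷-injective)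

    prodVec-length : ∀ L (xs : List A) → length (prodVec (Vec.replicate L xs)) ≡ length xs ^ L
    prodVec-length zero xs = refl
    prodVec-length (suc L) xs = pairs-length-≡ Vec._∷_ (λ _ → prodVec (Vec.replicate L xs)) {xs} (λ _ → prodVec-length L xs)

  module OutcomeSpace (N : ℕ) (ns : Fin N → ℕ) where
    open Setting N ns

    positionsOf : Fin N → List Pos
    positionsOf k = map (k ,_) (allFin (ns k))

    positions : List Pos
    positions = concatMap positionsOf (allFin N)

    positions-complete : ∀ p → p ∈ positions
    positions-complete (k , x) = ∈-concatMap⁺ positionsOf (lose (∈-allFin k) (∈-map⁺ (k ,_) (∈-allFin x)))

    positions-length : length positions ≡ total
    positions-length = trans (length-concatMap positionsOf (allFin N))
      (cong sum (map-cong {f = λ k → length (positionsOf k)} {g = ns} positionsOf-length (allFin N)))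
      where
        positionsOf-length : ∀ k → length (positionsOf k) ≡ ns k
        positionsOf-length k = trans (length-map {A = Fin (ns k)} {B = Pos} (k ,_) (allFin (ns k))) (length-tabulate {n = ns k} (λ x → x))

    mateSeqs-length : ∀ prev B {zs} → zs ∈ mateSeqs prev B → length zs ≡ length B
    mateSeqs-length prev [] (here refl) = refl
    mateSeqs-length prev (t ∷ B) zs∈
      with _ , zs' , _ , zs'∈ , refl ← pairs-∈⁻ _∷_ (λ _ → mateSeqs (source t ∷ prev) B) (candidates prev t) zs∈ =
      cong suc (mateSeqs-length (source t ∷ prev) B zs'∈)

    mateSeqs-unique : ∀ prev B → Unique (mateSeqs prev B)
    mateSeqs-unique prev [] = [] ∷ []
    mateSeqs-unique prev (t ∷ B) =
      pairs-unique _∷_ (λ _ → mateSeqs (source t ∷ prev) B) candidates-unique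
        (λ _ → mateSeqs-unique (source t ∷ prev) B) (λ _ _ _ _ → ∷-injective)
      where
        candidates-unique : Unique (candidates prev t)
        candidates-unique = Unique.map⁺ (λ { refl → refl })
          (Unique.filter⁺ (λ z → ¬? (DecMembership._∈?_ _≟Pos_ (k t , z) prev)) (Unique.allFin⁺ (ns (k t))))

    mateChoices : ∀ {m} → Vec BadEvent m → List (Vec (List Pos) m)
    mateChoices I = prodVec (Vec.map (mateSeqs []) I)

    mateChoices-length : ∀ {m} (I : Vec BadEvent m) {z} → z ∈ mateChoices I →
      ∀ i → length (Vec.lookup z i) ≡ length (Vec.lookup I i)
    mateChoices-length I {z} z∈ i = mateSeqs-length [] (Vec.lookup I i)
      (subst (Vec.lookup z i ∈_) (Vec.lookup-map i (mateSeqs []) I) (prodVec-sound (Vec.map (mateSeqs []) I) z∈ i))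

    outcomes-unique : ∀ {m} (I : Vec BadEvent m) → Unique (outcomes I)
    outcomes-unique {m} I = pairs-unique _,_ (λ _ → mateChoices I) (injSeqs-unique m [] m)
      (λ _ → prodVec-unique (Vec.map (mateSeqs []) I)
                (λ i → subst Unique (sym (Vec.lookup-map i (mateSeqs []) I)) (mateSeqs-unique [] (Vec.lookup I i))))
      (λ _ _ _ _ → λ { refl → refl , refl })

    outcomes-∈⁻ : ∀ {m} (I : Vec BadEvent m) {ρ z} → (ρ , z) ∈ outcomes I → ρ ∈ rankings m × z ∈ mateChoices I
    outcomes-∈⁻ {m} I o∈ with _ , _ , ρ∈ , z∈ , refl ← pairs-∈⁻ _,_ (λ _ → mateChoices I) (rankings m) o∈ = ρ∈ , z∈

    outcomes-∈⁺ : ∀ {m} (I : Vec BadEvent m) {ρ z} → ρ ∈ rankings m → z ∈ mateChoices I → (ρ , z) ∈ outcomes I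
    outcomes-∈⁺ I = pairs-∈⁺ _,_ (λ _ → mateChoices I)

-- The decoding of
-- long paths rests on the fact that such a sequence is determined by its
-- values in any order (sortedRearrangement-unique).
module Increasing where

  open import Data.Nat
  open import Data.Nat.Properties
  open import Data.Fin using (Fin; toℕ; fromℕ<; punchOut)
  open import Data.Fin.Properties using (any?; pigeonhole; toℕ-injective; toℕ-fromℕ<; toℕ<n; punchOut-injective)
    renaming (_≟_ to _≟ᶠ_)
  open import Data.Product using (∃; _×_; _,_; proj₁; proj₂)
  open import Data.Sum using (inj₁; inj₂)
  open import Function.Definitions using (Injective)
  open import Relation.Binary.PropositionalEquality
  open import Relation.Binary.Definitions using (tri<; tri≈; tri>)
  open import Relation.Nullary using (yes; no; contradiction)

  injective⇒onto : ∀ {T} (f : Fin T → Fin T) → Injective _≡_ _≡_ f → ∀ y → ∃ λ x → f x ≡ y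
  injective⇒onto {suc T} f f-inj y with any? (λ x → f x ≟ᶠ y)
  ... | yes hit = hit
  ... | no miss with i , j , i<j , e ← pigeonhole (n<1+n T) (λ x → punchOut {i = y} {j = f x} (λ e → miss (x , sym e))) =
    contradiction (cong toℕ (f-inj (punchOut-injective (λ e' → miss (i , sym e')) (λ e' → miss (j , sym e')) e))) (<⇒≢ i<j)

  StrictlyIncreasing : ∀ {T} → (Fin T → ℕ) → Set
  StrictlyIncreasing g = ∀ {i j} → toℕ i < toℕ j → g i < g j

  module _ {T : ℕ} {g : Fin T → ℕ} (g-inc : StrictlyIncreasing g) where

    strictlyIncreasing-reflects : ∀ {i j} → g i < g j → toℕ i < toℕ j
    strictlyIncreasing-reflects {i} {j} gi<gj with <-cmp (toℕ i) (toℕ j)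
    ... | tri< i<j _ _ = i<j
    ... | tri≈ _ i≡j _ = contradiction (cong g (toℕ-injective i≡j)) (<⇒≢ gi<gj)
    ... | tri> _ _ j<i = contradiction (g-inc j<i) (<⇒≯ gi<gj)

    strictlyIncreasing-injective : Injective _≡_ _≡_ g
    strictlyIncreasing-injective {i} {j} e with <-cmp (toℕ i) (toℕ j)
    ... | tri< i<j _ _ = contradiction e (<⇒≢ (g-inc i<j))
    ... | tri≈ _ i≡j _ = toℕ-injective i≡j
    ... | tri> _ _ j<i = contradiction (sym e) (<⇒≢ (g-inc j<i))

    strictlyIncreasing-inflationary : ∀ i → toℕ i ≤ g i
    strictlyIncreasing-inflationary i = atPosition (toℕ i) i refl
      where
        atPosition : ∀ a i → toℕ i ≡ a → a ≤ g i
        atPosition zero _ _ = z≤n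
        atPosition (suc a) i i≡1+a = ≤-trans (s≤s (atPosition a i' (toℕ-fromℕ< a<T))) (g-inc i'<i)
          where
            a<T : a < T
            a<T = <-trans (n<1+n a) (subst (_< T) i≡1+a (toℕ<n i))
            i' : Fin T
            i' = fromℕ< a<T
            i'<i : toℕ i' < toℕ i
            i'<i = subst₂ _<_ (sym (toℕ-fromℕ< a<T)) (sym i≡1+a) (n<1+n a)

  stepwise⇒strictlyIncreasing : ∀ (f : ℕ → ℕ) L → (∀ j → j < L → f j < f (suc j)) →
    StrictlyIncreasing {suc L} (λ i → f (toℕ i))
  stepwise⇒strictlyIncreasing f L step {j = j} i<j = chain i<j (s≤s⁻¹ (toℕ<n j))
    where
      chain : ∀ {a b} → a < b → b ≤ L → f a < f b
      chain {a} {suc b} a<1+b 1+b≤L with m<1+n⇒m<n∨m≡n a<1+b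
      ... | inj₁ a<b = <-trans (chain a<b (<⇒≤ 1+b≤L)) (step b 1+b≤L)
      ... | inj₂ refl = step b 1+b≤L

  -- Two strictly increasing sequences taking the same set of values coincide:
  -- matching each index with the position of its value gives increasing maps τ, τ'
  -- with τ' ∘ τ = id, and i ≤ τ i ≤ τ' (τ i) = i.
  strictlyIncreasing-sameValues : ∀ {T} {g₁ g₂ : Fin T → ℕ} → StrictlyIncreasing g₁ → StrictlyIncreasing g₂ →
    (∀ i → ∃ λ j → g₁ i ≡ g₂ j) → (∀ j → ∃ λ i → g₂ j ≡ g₁ i) → ∀ i → g₁ i ≡ g₂ i
  strictlyIncreasing-sameValues {T} {g₁} {g₂} inc₁ inc₂ val₁ val₂ i =
    trans (proj₂ (val₁ i)) (cong g₂ (toℕ-injective (≤-antisym τi≤i i≤τi)))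
    where
      τ τ' : Fin T → Fin T
      τ i = proj₁ (val₁ i)
      τ' j = proj₁ (val₂ j)
      τ-inc : StrictlyIncreasing (λ i → toℕ (τ i))
      τ-inc i<j = strictlyIncreasing-reflects inc₂ (subst₂ _<_ (proj₂ (val₁ _)) (proj₂ (val₁ _)) (inc₁ i<j))
      τ'-inc : StrictlyIncreasing (λ j → toℕ (τ' j))
      τ'-inc i<j = strictlyIncreasing-reflects inc₁ (subst₂ _<_ (proj₂ (val₂ _)) (proj₂ (val₂ _)) (inc₂ i<j))
      τ'τi≡i : τ' (τ i) ≡ i
      τ'τi≡i = strictlyIncreasing-injective inc₁ (trans (sym (proj₂ (val₂ (τ i)))) (sym (proj₂ (val₁ i))))
      i≤τi : toℕ i ≤ toℕ (τ i)
      i≤τi = strictlyIncreasing-inflationary τ-inc i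
      τi≤i : toℕ (τ i) ≤ toℕ i
      τi≤i = subst (λ k → toℕ (τ i) ≤ toℕ k) τ'τi≡i (strictlyIncreasing-inflationary τ'-inc (τ i))

  sortedRearrangement-unique : ∀ {T} {g₁ g₂ : Fin T → ℕ} {σ₁ σ₂ : Fin T → Fin T} →
    StrictlyIncreasing g₁ → StrictlyIncreasing g₂ → Injective _≡_ _≡_ σ₁ → Injective _≡_ _≡_ σ₂ →
    (∀ i → g₁ (σ₁ i) ≡ g₂ (σ₂ i)) → (∀ i → g₁ i ≡ g₂ i) × (∀ i → σ₁ i ≡ σ₂ i)
  sortedRearrangement-unique {g₁ = g₁} {g₂} {σ₁} {σ₂} inc₁ inc₂ σ₁-inj σ₂-inj same = g₁≗g₂ , σ₁≗σ₂
    where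
      val₁ : ∀ k → ∃ λ j → g₁ k ≡ g₂ j
      val₁ k with i , refl ← injective⇒onto σ₁ σ₁-inj k = σ₂ i , same i
      val₂ : ∀ k → ∃ λ j → g₂ k ≡ g₁ j
      val₂ k with i , refl ← injective⇒onto σ₂ σ₂-inj k = σ₁ i , sym (same i)
      g₁≗g₂ : ∀ i → g₁ i ≡ g₂ i
      g₁≗g₂ = strictlyIncreasing-sameValues inc₁ inc₂ val₁ val₂
      σ₁≗σ₂ : ∀ i → σ₁ i ≡ σ₂ i
      σ₁≗σ₂ i = strictlyIncreasing-injective inc₁ (trans (same i) (sym (g₁≗g₂ (σ₂ i))))

module Rearrangement where

  open Increasing
  open import Data.Nat using (ℕ)
  open import Data.Fin using (Fin; toℕ)
  open import Data.Fin.Properties using (any?; toℕ-injective) renaming (_≟_ to _≟ᶠ_)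
  open import Data.Vec as Vec using (Vec)
  import Data.Vec.Properties as Vec
  open import Data.Product using (∃; _×_; _,_; proj₁; proj₂)
  open import Function.Definitions using (Injective)
  open import Relation.Binary.PropositionalEquality
  open import Relation.Nullary using (¬_; Dec; yes; no; contradiction)

  lookup-extensionality : ∀ {A : Set} {n} (u v : Vec A n) → (∀ i → Vec.lookup u i ≡ Vec.lookup v i) → u ≡ v
  lookup-extensionality u v same = trans (sym (Vec.tabulate∘lookup u)) (trans (Vec.tabulate-cong same) (Vec.tabulate∘lookup v))

  module _ {m T : ℕ} (w : Fin T → Fin m) (w-inj : Injective _≡_ _≡_ w) where

    newRank : Vec (Fin m) m → (Fin T → Fin T) → ∀ j → Dec (∃ λ i → w i ≡ j) → Fin m
    newRank ρ σ j (yes (i , _)) = Vec.lookup ρ (w (σ i))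
    newRank ρ σ j (no _) = Vec.lookup ρ j

    rearrange : Vec (Fin m) m → (Fin T → Fin T) → Vec (Fin m) m
    rearrange ρ σ = Vec.tabulate (λ j → newRank ρ σ j (any? (λ i → w i ≟ᶠ j)))

    rearrange-on : ∀ ρ σ i → Vec.lookup (rearrange ρ σ) (w i) ≡ Vec.lookup ρ (w (σ i))
    rearrange-on ρ σ i rewrite Vec.lookup∘tabulate (λ j → newRank ρ σ j (any? (λ i → w i ≟ᶠ j))) (w i) with any? (λ i' → w i' ≟ᶠ w i)
    ... | yes (i' , e) = cong (λ k → Vec.lookup ρ (w (σ k))) (w-inj e)
    ... | no miss = contradiction (i , refl) miss

    rearrange-off : ∀ ρ σ j → ¬ (∃ λ i → w i ≡ j) → Vec.lookup (rearrange ρ σ) j ≡ Vec.lookup ρ j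
    rearrange-off ρ σ j off rewrite Vec.lookup∘tabulate (λ j → newRank ρ σ j (any? (λ i → w i ≟ᶠ j))) j with any? (λ i' → w i' ≟ᶠ j)
    ... | yes hit = contradiction hit off
    ... | no _ = refl

    rearrange-injective : ∀ {ρ σ} → Injective _≡_ _≡_ (Vec.lookup ρ) → Injective _≡_ _≡_ σ →
      Injective _≡_ _≡_ (Vec.lookup (rearrange ρ σ))
    rearrange-injective {ρ} {σ} ρ-inj σ-inj {a} {b} e
      rewrite Vec.lookup∘tabulate (λ j → newRank ρ σ j (any? (λ i → w i ≟ᶠ j))) a
            | Vec.lookup∘tabulate (λ j → newRank ρ σ j (any? (λ i → w i ≟ᶠ j))) b
      with any? (λ i → w i ≟ᶠ a) | any? (λ i → w i ≟ᶠ b)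
    ... | yes (i , refl) | yes (i' , refl) = cong w (σ-inj (w-inj (ρ-inj e)))
    ... | yes (i , _) | no b-off = contradiction (σ i , ρ-inj e) b-off
    ... | no a-off | yes (i' , _) = contradiction (σ i' , ρ-inj (sym e)) a-off
    ... | no _ | no _ = ρ-inj e

    rearrange-unique : ∀ {ρ₁ ρ₂ σ₁ σ₂} →
      StrictlyIncreasing (λ i → toℕ (Vec.lookup ρ₁ (w i))) → StrictlyIncreasing (λ i → toℕ (Vec.lookup ρ₂ (w i))) →
      Injective _≡_ _≡_ σ₁ → Injective _≡_ _≡_ σ₂ →
      rearrange ρ₁ σ₁ ≡ rearrange ρ₂ σ₂ → ρ₁ ≡ ρ₂ × (∀ i → σ₁ i ≡ σ₂ i)
    rearrange-unique {ρ₁} {ρ₂} {σ₁} {σ₂} inc₁ inc₂ σ₁-inj σ₂-inj same =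
      lookup-extensionality ρ₁ ρ₂ sameRank , proj₂ sorted
      where
        sameOnPath : ∀ i → toℕ (Vec.lookup ρ₁ (w (σ₁ i))) ≡ toℕ (Vec.lookup ρ₂ (w (σ₂ i)))
        sameOnPath i = cong toℕ (begin
          Vec.lookup ρ₁ (w (σ₁ i))               ≡⟨ rearrange-on ρ₁ σ₁ i ⟨
          Vec.lookup (rearrange ρ₁ σ₁) (w i)     ≡⟨ cong (λ ρ → Vec.lookup ρ (w i)) same ⟩
          Vec.lookup (rearrange ρ₂ σ₂) (w i)     ≡⟨ rearrange-on ρ₂ σ₂ i ⟩
          Vec.lookup ρ₂ (w (σ₂ i))               ∎)
          where open ≡-Reasoning
        sorted : (∀ i → toℕ (Vec.lookup ρ₁ (w i)) ≡ toℕ (Vec.lookup ρ₂ (w i))) × (∀ i → σ₁ i ≡ σ₂ i)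
        sorted = sortedRearrangement-unique inc₁ inc₂ σ₁-inj σ₂-inj sameOnPath
        sameRank : ∀ j → Vec.lookup ρ₁ j ≡ Vec.lookup ρ₂ j
        sameRank j with any? (λ i → w i ≟ᶠ j)
        ... | yes (i , refl) = toℕ-injective (proj₁ sorted i)
        ... | no off = trans (sym (rearrange-off ρ₁ σ₁ j off))
                         (trans (cong (λ ρ → Vec.lookup ρ j) same) (rearrange-off ρ₂ σ₂ j off))

  rearrange-cong : ∀ {m T} {w₁ w₂ : Fin T → Fin m} (w₁-inj : Injective _≡_ _≡_ w₁) (w₂-inj : Injective _≡_ _≡_ w₂) →
    (∀ i → w₁ i ≡ w₂ i) → ∀ ρ σ → rearrange w₁ w₁-inj ρ σ ≡ rearrange w₂ w₂-inj ρ σ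
  rearrange-cong {w₁ = w₁} {w₂} w₁-inj w₂-inj w₁≗w₂ ρ σ = lookup-extensionality _ _ sameEntry
    where
      sameEntry : ∀ j → Vec.lookup (rearrange w₁ w₁-inj ρ σ) j ≡ Vec.lookup (rearrange w₂ w₂-inj ρ σ) j
      sameEntry j with any? (λ i → w₁ i ≟ᶠ j)
      ... | yes (i , refl) = begin
        Vec.lookup (rearrange w₁ w₁-inj ρ σ) (w₁ i)   ≡⟨ rearrange-on w₁ w₁-inj ρ σ i ⟩
        Vec.lookup ρ (w₁ (σ i))                        ≡⟨ cong (Vec.lookup ρ) (w₁≗w₂ (σ i)) ⟩
        Vec.lookup ρ (w₂ (σ i))                        ≡⟨ rearrange-on w₂ w₂-inj ρ σ i ⟨
        Vec.lookup (rearrange w₂ w₂-inj ρ σ) (w₂ i)   ≡⟨ cong (Vec.lookup (rearrange w₂ w₂-inj ρ σ)) (w₁≗w₂ i) ⟨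
        Vec.lookup (rearrange w₂ w₂-inj ρ σ) (w₁ i)   ∎
        where open ≡-Reasoning
      ... | no off = trans (rearrange-off w₁ w₁-inj ρ σ j off)
        (sym (rearrange-off w₂ w₂-inj ρ σ j (λ { (i , e) → off (i , trans (w₁≗w₂ i) e) })))

module LongPaths (N : ℕ) (ns : Fin N → ℕ) {m : ℕ} (I : Vec (Setting.BadEvent N ns) m) where

  open Setting N ns
  open FiniteLists
  open Enumerations
  open OutcomeSpace N ns
  open Increasing
  open Rearrangement
  open Pairs
  open import Data.Nat
  open import Data.Nat.Properties
  open import Data.Fin using (Fin; zero; suc; toℕ; fromℕ<; inject₁)
  open import Data.Fin.Properties using (toℕ-injective; toℕ-fromℕ<; toℕ<n; toℕ-inject₁) renaming (_≟_ to _≟ᶠ_)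
  open import Data.List using (List; []; length; lookup; map; allFin)
  open import Data.List.Properties using (length-map; length-tabulate)
  open import Data.List.Membership.Propositional using (_∈_)
  open import Data.List.Membership.Propositional.Properties using (∈-map⁻; ∈-allFin; ∈-lookup)
  import Data.List.Relation.Unary.All as All
  open import Data.List.Relation.Unary.Unique.Propositional using (Unique)
  import Data.List.Relation.Unary.Unique.Propositional.Properties as Unique
  open import Data.List.Relation.Unary.Any using (index)
  open import Data.List.Relation.Unary.Any.Properties using (lookup-index)
  open import Data.Vec as Vec using (Vec)
  import Data.Vec.Properties as Vec
  open import Data.Product using (∃; _×_; _,_; proj₁; proj₂)
  open import Data.Sum using (inj₁)
  open import Relation.Binary.PropositionalEquality
  open import Function.Definitions using (Injective)
  open import Relation.Nullary using (yes; no; contradiction)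

  sources : Fin m → List Pos
  sources i = map source (Vec.lookup I i)

  source-owner : Independent I → ∀ {a b p} → p ∈ sources a → p ∈ sources b → a ≡ b
  source-owner independent {a} {b} p∈a p∈b with a ≟ᶠ b
  ... | yes a≡b = a≡b
  ... | no a≢b with t , t∈ , refl ← ∈-map⁻ source p∈a with t' , t'∈ , e ← ∈-map⁻ source p∈b =
    contradiction (t , t' , t∈ , t'∈ , inj₁ e) (independent a b a≢b)

  -- The vertices of a path with L' edges as an ℕ-indexed sequence (padded beyond L').
  module PathVertices {o : Outcome m} {L' : ℕ} (path : Path I o L') where

    vertex : ℕ → Fin m
    vertex j with j <? suc L'
    ... | yes j≤L' = Vec.lookup (proj₁ path) (fromℕ< j≤L')
    ... | no _ = Vec.lookup (proj₁ path) zero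

    vertex-at : ∀ (i : Fin (suc L')) → vertex (toℕ i) ≡ Vec.lookup (proj₁ path) i
    vertex-at i with toℕ i <? suc L'
    ... | yes i≤L' = cong (Vec.lookup (proj₁ path)) (toℕ-injective (toℕ-fromℕ< i≤L'))
    ... | no i≰L' = contradiction (toℕ<n i) i≰L'

    vertex-edge : ∀ j → j < L' → Edge I o (vertex j) (vertex (suc j))
    vertex-edge j j<L' = subst₂ (Edge I o)
      (sym (trans (cong vertex j≡) (vertex-at (inject₁ l))))
      (sym (trans (cong (λ k → vertex (suc k)) (sym (toℕ-fromℕ< j<L'))) (vertex-at (suc l))))
      (proj₂ path l)
      where
        l : Fin L'
        l = fromℕ< j<L'
        j≡ : j ≡ toℕ (inject₁ l)
        j≡ = sym (trans (toℕ-inject₁ l) (toℕ-fromℕ< j<L'))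

  module Encoding (M L : ℕ) (small : ∀ i → size (Vec.lookup I i) ≤ M) where

    Code : Set
    Code = Pos × Vec (Fin M) L

    codes : List Code
    codes = pairs _,_ (λ _ → prodVec (Vec.replicate L (allFin M))) positions

    codes-complete : ∀ c → c ∈ codes
    codes-complete (p , hops) = pairs-∈⁺ _,_ (λ _ → prodVec (Vec.replicate L (allFin M))) (positions-complete p)
      (prodVec-complete (Vec.replicate L (allFin M)) hops
        (λ i → subst (Vec.lookup hops i ∈_) (sym (Vec.lookup-replicate i (allFin M))) (∈-allFin _)))

    codes-length : length codes ≡ total * M ^ L
    codes-length = trans (pairs-length-≡ _,_ (λ _ → prodVec (Vec.replicate L (allFin M))) {positions}
        (λ _ → trans (prodVec-length L (allFin M)) (cong (_^ L) (length-tabulate {n = M} (λ x → x)))))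
      (cong (_* M ^ L) positions-length)

    encodings : List (Outcome m × Code)
    encodings = pairs _,_ (λ _ → codes) (outcomes I)

    encodings-length : length encodings ≡ length (outcomes I) * (total * M ^ L)
    encodings-length = pairs-length-≡ _,_ (λ _ → codes) {outcomes I} (λ _ → codes-length)

    module Walk {ρ z} (o∈ : (ρ , z) ∈ outcomes I) (long : LongPath I (ρ , z) L) where
      open PathVertices {o = ρ , z} (proj₂ (proj₂ long))

      walkAt : ℕ → Fin m
      walkAt j = vertex (suc j)

      walk : Fin (suc L) → Fin m
      walk i = walkAt (toℕ i)

      edgeAt : ∀ j → j < L → Edge I (ρ , z) (walkAt j) (walkAt (suc j))
      edgeAt j j<L = vertex-edge (suc j) (<-≤-trans (s≤s j<L) (proj₁ (proj₂ long)))

      walk-increasing : StrictlyIncreasing (λ i → toℕ (Vec.lookup ρ (walk i)))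
      walk-increasing = stepwise⇒strictlyIncreasing (λ j → toℕ (Vec.lookup ρ (walkAt j))) L (λ j j<L → proj₁ (edgeAt j j<L))

      walk-injective : ∀ {i j} → walk i ≡ walk j → i ≡ j
      walk-injective e = strictlyIncreasing-injective walk-increasing (cong (λ v → toℕ (Vec.lookup ρ v)) e)

      entry : Pos
      entry = proj₁ (proj₂ (vertex-edge 0 (≤-<-trans z≤n (proj₁ (proj₂ long)))))

      entry∈sources : entry ∈ sources (walkAt 0)
      entry∈sources = proj₂ (proj₂ (proj₂ (vertex-edge 0 (≤-<-trans z≤n (proj₁ (proj₂ long))))))

      hopEdge : (i : Fin L) → Edge I (ρ , z) (walkAt (toℕ i)) (walkAt (suc (toℕ i)))
      hopEdge i = edgeAt (toℕ i) (toℕ<n i)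

      hop : Fin L → Pos
      hop i = proj₁ (proj₂ (hopEdge i))

      hop∈mates : ∀ i → hop i ∈ Vec.lookup z (walkAt (toℕ i))
      hop∈mates i = proj₁ (proj₂ (proj₂ (hopEdge i)))

      hop∈sources : ∀ i → hop i ∈ sources (walkAt (suc (toℕ i)))
      hop∈sources i = proj₂ (proj₂ (proj₂ (hopEdge i)))

      hopIndex<M : ∀ i → toℕ (index (hop∈mates i)) < M
      hopIndex<M i = <-≤-trans (toℕ<n (index (hop∈mates i)))
        (≤-trans (≤-reflexive (mateChoices-length I (proj₂ (outcomes-∈⁻ I o∈)) (walkAt (toℕ i)))) (small (walkAt (toℕ i))))

      code : Code
      code = entry , Vec.tabulate (λ i → fromℕ< (hopIndex<M i))

      encode : Vec (Fin (suc L)) (suc L) → Outcome m × Code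
      encode σ = (rearrange walk walk-injective ρ (Vec.lookup σ) , z) , code

      encode∈ : ∀ {σ} → σ ∈ rankings (suc L) → encode σ ∈ encodings
      encode∈ {σ} σ∈ = pairs-∈⁺ _,_ (λ _ → codes)
        (outcomes-∈⁺ I (injSeqs-complete m [] m _ rearranged-injective (λ _ ())) (proj₂ (outcomes-∈⁻ I o∈)))
        (codes-complete code)
        where
          rearranged-injective : Injective _≡_ _≡_ (Vec.lookup (rearrange walk walk-injective ρ (Vec.lookup σ)))
          rearranged-injective = rearrange-injective walk walk-injective
            (proj₁ (injSeqs-sound m [] m (proj₁ (outcomes-∈⁻ I o∈))))
            (proj₁ (injSeqs-sound (suc L) [] (suc L) σ∈))

    -- The entry position and the hop indices determine the walk, since each position is the
    -- swap-source of only one event; the walk then determines ρ and σ by rearrange-unique.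
    module Decode (independent : Independent I)
        {ρ₁ z₁} (o₁∈ : (ρ₁ , z₁) ∈ outcomes I) (long₁ : LongPath I (ρ₁ , z₁) L)
        {ρ₂ z₂} (o₂∈ : (ρ₂ , z₂) ∈ outcomes I) (long₂ : LongPath I (ρ₂ , z₂) L)
        {σ₁ σ₂} (σ₁∈ : σ₁ ∈ rankings (suc L)) (σ₂∈ : σ₂ ∈ rankings (suc L))
        (same : Walk.encode o₁∈ long₁ σ₁ ≡ Walk.encode o₂∈ long₂ σ₂) where

      module W₁ = Walk o₁∈ long₁
      module W₂ = Walk o₂∈ long₂

      same-mates : z₁ ≡ z₂
      same-mates = cong (λ e → proj₂ (proj₁ e)) same

      same-hopIndex : ∀ i → toℕ (index (W₁.hop∈mates i)) ≡ toℕ (index (W₂.hop∈mates i))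
      same-hopIndex i = begin
        toℕ (index (W₁.hop∈mates i))      ≡⟨ toℕ-fromℕ< (W₁.hopIndex<M i) ⟨
        toℕ (fromℕ< (W₁.hopIndex<M i))    ≡⟨ cong toℕ (Vec.lookup∘tabulate _ i) ⟨
        toℕ (Vec.lookup (proj₂ W₁.code) i) ≡⟨ cong (λ e → toℕ (Vec.lookup (proj₂ (proj₂ e)) i)) same ⟩
        toℕ (Vec.lookup (proj₂ W₂.code) i) ≡⟨ cong toℕ (Vec.lookup∘tabulate _ i) ⟩
        toℕ (fromℕ< (W₂.hopIndex<M i))    ≡⟨ toℕ-fromℕ< (W₂.hopIndex<M i) ⟩
        toℕ (index (W₂.hop∈mates i))      ∎
        where open ≡-Reasoning

      same-hop : ∀ i → W₁.walkAt (toℕ i) ≡ W₂.walkAt (toℕ i) → W₁.hop i ≡ W₂.hop i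
      same-hop i same-vertex = begin
        W₁.hop i                                           ≡⟨ lookup-index (W₁.hop∈mates i) ⟩
        lookup (Vec.lookup z₁ (W₁.walkAt (toℕ i))) (index (W₁.hop∈mates i))
          ≡⟨ lookup-cong (cong₂ Vec.lookup same-mates same-vertex) (same-hopIndex i) ⟩
        lookup (Vec.lookup z₂ (W₂.walkAt (toℕ i))) (index (W₂.hop∈mates i)) ≡⟨ lookup-index (W₂.hop∈mates i) ⟨
        W₂.hop i                                           ∎
        where
          open ≡-Reasoning
          lookup-cong : ∀ {A : Set} {xs ys : List A} {i j} → xs ≡ ys → toℕ i ≡ toℕ j → lookup xs i ≡ lookup ys j
          lookup-cong {xs = xs} refl i≡j = cong (lookup xs) (toℕ-injective i≡j)

      same-walkAt : ∀ j → j ≤ L → W₁.walkAt j ≡ W₂.walkAt j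
      same-walkAt zero _ = source-owner independent W₁.entry∈sources
        (subst (_∈ _) (cong (λ e → proj₁ (proj₂ e)) (sym same)) W₂.entry∈sources)
      same-walkAt (suc j) j<L = subst (λ k → W₁.walkAt (suc k) ≡ W₂.walkAt (suc k)) (toℕ-fromℕ< j<L)
        (source-owner independent (W₁.hop∈sources i) (subst (_∈ _) (sym (same-hop i previous)) (W₂.hop∈sources i)))
        where
          i : Fin L
          i = fromℕ< j<L
          previous : W₁.walkAt (toℕ i) ≡ W₂.walkAt (toℕ i)
          previous = subst (λ k → W₁.walkAt k ≡ W₂.walkAt k) (sym (toℕ-fromℕ< j<L)) (same-walkAt j (<⇒≤ j<L))

      same-walk : ∀ i → W₁.walk i ≡ W₂.walk i
      same-walk i = same-walkAt (toℕ i) (s≤s⁻¹ (toℕ<n i))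

      recovered : ρ₁ ≡ ρ₂ × (∀ i → Vec.lookup σ₁ i ≡ Vec.lookup σ₂ i)
      recovered = rearrange-unique W₁.walk W₁.walk-injective W₁.walk-increasing
        (λ i<j → subst₂ _<_ (rank₂ _) (rank₂ _) (W₂.walk-increasing i<j))
        (proj₁ (injSeqs-sound (suc L) [] (suc L) σ₁∈)) (proj₁ (injSeqs-sound (suc L) [] (suc L) σ₂∈))
        (trans (cong (λ e → proj₁ (proj₁ e)) same)
               (rearrange-cong W₂.walk-injective W₁.walk-injective (λ i → sym (same-walk i)) ρ₂ (Vec.lookup σ₂)))
        where
          rank₂ : ∀ i → toℕ (Vec.lookup ρ₂ (W₂.walk i)) ≡ toℕ (Vec.lookup ρ₂ (W₁.walk i))
          rank₂ i = cong (λ v → toℕ (Vec.lookup ρ₂ v)) (sym (same-walk i))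

      encode-injective : (ρ₁ , z₁) ≡ (ρ₂ , z₂) × σ₁ ≡ σ₂
      encode-injective = cong₂ _,_ (proj₁ recovered) same-mates , lookup-extensionality σ₁ σ₂ (proj₂ recovered)

    -- Double counting: pairs (long-path outcome, permutation of L+1 objects) inject into
    -- the encodings, so (number of such outcomes) · (L+1)! ≤ |outcomes| · n · M^L.
    longPaths-count : Independent I → (S : List (Fin (length (outcomes I)))) → Unique S →
      All (λ s → LongPath I (lookup (outcomes I) s) L) S →
      length S * suc L ! ≤ length (outcomes I) * (total * M ^ L)
    longPaths-count independent S S-unique long = begin
      length S * suc L !                         ≤⟨ *-monoʳ-≤ (length S) (rankings-length (suc L)) ⟩
      length S * length (rankings (suc L))       ≡⟨ cong (_* length (rankings (suc L))) witnessed-length ⟨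
      length witnessed * length (rankings (suc L)) ≡⟨ pairs-length-≡ encodeAt (λ _ → rankings (suc L)) {witnessed} (λ _ → refl) ⟨
      length (pairs encodeAt (λ _ → rankings (suc L)) witnessed)
        ≤⟨ unique⇒length≤ encoded-unique encoded⊆encodings ⟩
      length encodings                           ≡⟨ encodings-length ⟩
      length (outcomes I) * (total * M ^ L)      ∎
      where
        open ≤-Reasoning
        Witnessed : Set
        Witnessed = ∃ λ s → LongPath I (lookup (outcomes I) s) L

        witnessed : List Witnessed
        witnessed = All.toList long

        witnessed-length : length witnessed ≡ length S
        witnessed-length = trans (sym (length-map proj₁ witnessed)) (cong length (toList-keys long))

        witnessed-keys-unique : Unique (map proj₁ witnessed)
        witnessed-keys-unique = subst Unique (sym (toList-keys long)) S-unique

        encodeAt : Witnessed → Vec (Fin (suc L)) (suc L) → Outcome m × Code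
        encodeAt (s , long-s) = Walk.encode (∈-lookup s) long-s

        encoded-unique : Unique (pairs encodeAt (λ _ → rankings (suc L)) witnessed)
        encoded-unique = pairs-unique encodeAt (λ _ → rankings (suc L))
          (Unique.map⁻ witnessed-keys-unique)
          (λ _ → injSeqs-unique (suc L) [] (suc L))
          λ { {s , long-s} {s' , long-s'} a∈ a'∈ σ∈ σ'∈ e →
              let same-outcome , same-σ = Decode.encode-injective independent (∈-lookup s) long-s (∈-lookup s') long-s' σ∈ σ'∈ e
              in unique-key proj₁ witnessed-keys-unique a∈ a'∈
                   (lookup-injective (outcomes-unique I) same-outcome) , same-σ }

        encoded⊆encodings : ∀ {c} → c ∈ pairs encodeAt (λ _ → rankings (suc L)) witnessed → c ∈ encodings
        encoded⊆encodings {c} c∈ with (s , long-s) , σ , _ , σ∈ , refl ← pairs-∈⁻ encodeAt (λ _ → rankings (suc L)) witnessed c∈ =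
          Walk.encode∈ (∈-lookup s) long-s σ∈

longPaths-rare : ∀ (N : ℕ) (ns : Fin N → ℕ) (M m : ℕ) (I : Vec (Setting.BadEvent N ns) m) →
  (∀ i → Setting.size N ns (Vec.lookup I i) ≤ M) → Setting.Independent N ns I →
  ∀ (S : List (Fin (length (Setting.outcomes N ns I)))) → Unique S →
  All (λ o → Setting.LongPath N ns I (lookup (Setting.outcomes N ns I) o) (32 * suc (M + ⌊log₂ Setting.total N ns ⌋))) S →
  length S * Setting.total N ns ≤ length (Setting.outcomes N ns I)
longPaths-rare N ns M m I small independent S S-unique long =
  *-cancelʳ-≤ (length S * n) (length Ω) (suc L !) {{suc L !≢0}} (begin
    length S * n * suc L !          ≡⟨ xy∙z≈y∙xz (length S) n (suc L !) ⟩
    n * (length S * suc L !)        ≤⟨ *-monoʳ-≤ n (Encoding.longPaths-count M L small independent S S-unique long) ⟩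
    n * (length Ω * (n * M ^ L))    ≡⟨ x∙yz≈y∙xz n (length Ω) (n * M ^ L) ⟩
    length Ω * (n * (n * M ^ L))    ≤⟨ *-monoʳ-≤ (length Ω) (pathBudget n M) ⟩
    length Ω * suc L !              ∎)
  where
    open LongPaths N ns I
    open Arithmetic using (pathBudget)
    open import Data.Nat using (_!)
    open import Data.Nat.Properties using (*-cancelʳ-≤; *-monoʳ-≤; _!≢0; *-commutativeSemigroup; module ≤-Reasoning)
    open import Algebra.Properties.CommutativeSemigroup *-commutativeSemigroup using (x∙yz≈y∙xz; xy∙z≈y∙xz)
    open ≤-Reasoning
    n L : ℕ
    n = Setting.total N ns
    L = 32 * suc (M + ⌊log₂ n ⌋)
    Ω : List (Setting.Outcome N ns m)
    Ω = Setting.outcomes N ns I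

proposition7p1 : Σ ℕ λ C → Σ ℕ λ c → Σ ℕ λ p → Σ ℕ λ q →
    ∀ (N : ℕ) (ns : Fin N → ℕ) (π : (j : Fin N) → Permutation′ (ns j)) (M m : ℕ)
      (I : Vec (Setting.BadEvent N ns) m) →
    (∀ i → Setting.WellFormed N ns (Vec.lookup I i)) →
    (∀ i → Setting.size N ns (Vec.lookup I i) ≤ M) →
    (∀ i → Setting.IsTrue N ns π (Vec.lookup I i)) →
    (∀ i j → Vec.lookup I i ≡ Vec.lookup I j → i ≡ j) →
    Setting.Independent N ns I →
    ∀ (S : List (Fin (length (Setting.outcomes N ns I)))) → Unique S →
    All (λ o → Setting.LongPath N ns I (lookup (Setting.outcomes N ns I) o)
                 (C * suc (M + ⌊log₂ Setting.total N ns ⌋))) S →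
    length S ^ suc q * Setting.total N ns ^ suc p
      ≤ c * length (Setting.outcomes N ns I) ^ suc q
proposition7p1 = 32 , 1 , 0 , 0 , λ N ns _ M m I _ small _ _ independent S S-unique long →
  subst₂ _≤_ (sym (cong₂ _*_ (*-identityʳ (length S)) (*-identityʳ (Setting.total N ns))))
             (sym (trans (*-identityˡ _) (*-identityʳ _)))
             (longPaths-rare N ns M m I small independent S S-unique long)
  where
    open import Data.Nat.Properties using (*-identityʳ; *-identityˡ)
    open import Relation.Binary.PropositionalEquality using (subst₂; sym; trans; cong₂)
    open import Data.Product using (_,_)
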